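{- For every positive integer $k$ and every integer $q$ with $|q|\le 2^k$, there is a connected finite simple graph $G$ with $\phi(G)=k$ and $I(G;-1)=q$.
   Context: All graphs are finite and simple. For a graph $G$, the independence polynomial is $I(G;x)=\sum_{j=0}^{\alpha(G)} s_j x^j$, where $s_j$ is the number of independent sets of size $j$ in $G$ (so $s_0=1$, counting the empty set) and $\alpha(G)$ is the maximum size of an independent set. The decycling number $\phi(G)$ is the minimum size of a set $S\subseteq V(G)$ such that $G-S$ is acyclic. -}

module Defs where

open import Data.Nat using (ℕ; zero; suc; _+_; _≤_; _≟_)
open import Data.Nat.DivMod using (_%_; m%n<n)
open import Data.Integer as ℤ using (ℤ; +_; -_)
open import Data.Bool using (Bool; true; false)
import Data.Bool as B
open import Data.Fin using (Fin; toℕ; fromℕ<)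
open import Data.Fin.Properties using (all?)
open import Data.Fin.Subset using (Subset; _∈_; _∉_; ∣_∣; inside; outside)
open import Data.Fin.Subset.Properties using (_∈?_)
open import Data.Vec using ([]; _∷_)
open import Data.List using (List; []; _∷_; [_]; _++_; map; filter; length)
open import Data.Product using (Σ; ∃; _×_; _,_)
open import Function.Definitions using (Injective)
open import Relation.Nullary using (¬_; Dec)
open import Relation.Nullary.Decidable using (_×-dec_; _→-dec_)
open import Relation.Binary.PropositionalEquality using (_≡_)

record Graph : Set where
  field
    n      : ℕ
    adj    : Fin n → Fin n → Bool
    sym    : ∀ u v → adj u v ≡ adj v u
    irrefl : ∀ v → adj v v ≡ false

open Graph public

Adj : (G : Graph) → Fin (n G) → Fin (n G) → Set
Adj G u v = adj G u v ≡ true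

data Walk (G : Graph) : Fin (n G) → Fin (n G) → Set where
  here : ∀ {u} → Walk G u u
  step : ∀ {u w v} → Adj G u w → Walk G w v → Walk G u v

Connected : Graph → Set
Connected G = ∀ u v → Walk G u v

Independent : (G : Graph) → Subset (n G) → Set
Independent G S = ∀ u v → u ∈ S → v ∈ S → adj G u v ≡ false

independent? : (G : Graph) → (S : Subset (n G)) → Dec (Independent G S)
independent? G S =
  all? λ u → all? λ v → (u ∈? S) →-dec ((v ∈? S) →-dec (adj G u v B.≟ false))

allSubsets : (m : ℕ) → List (Subset m)
allSubsets zero = [ [] ]
allSubsets (suc m) = map (inside ∷_) (allSubsets m) ++ map (outside ∷_) (allSubsets m)

indepCount : (G : Graph) → ℕ → ℕ
indepCount G j =
  length (filter (λ S → independent? G S ×-dec (∣ S ∣ ≟ j)) (allSubsets (n G)))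

signPow : ℕ → ℤ
signPow zero = + 1
signPow (suc j) = - signPow j

partialEval : (G : Graph) → ℕ → ℤ
partialEval G zero = + indepCount G 0
partialEval G (suc m) = partialEval G m ℤ.+ (+ indepCount G (suc m)) ℤ.* signPow (suc m)

-- I(G;-1) = Σ_j s_j (-1)^j ; summing up to j = n (≥ α(G)) since s_j = 0 for j > α(G)
indepPolyAtMinusOne : Graph → ℤ
indepPolyAtMinusOne G = partialEval G (n G)

nextIdx : (L : ℕ) → Fin (3 + L) → Fin (3 + L)
nextIdx L i = fromℕ< (m%n<n (suc (toℕ i)) (3 + L))

record Cycle (G : Graph) : Set where
  field
    len       : ℕ
    vert      : Fin (3 + len) → Fin (n G)
    distinct  : Injective _≡_ _≡_ vert
    adjacent  : ∀ i → Adj G (vert i) (vert (nextIdx len i))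

AcyclicAfterRemoving : (G : Graph) → Subset (n G) → Set
AcyclicAfterRemoving G S = ¬ (Σ (Cycle G) λ C → ∀ i → Cycle.vert C i ∉ S)

DecyclingNumber : Graph → ℕ → Set
DecyclingNumber G k =
  (Σ (Subset (n G)) λ S → AcyclicAfterRemoving G S × ∣ S ∣ ≡ k)
  × (∀ S → AcyclicAfterRemoving G S → k ≤ ∣ S ∣)

-- Build a graph one vertex at a time. At the newest vertex v,
-- I(G; -1) = I(G - v; -1) - I(G - N[v]; -1), and gluing a rooted gadget H by an edge from v to its
-- root r gives I(G ⊕ H) = I(G - v) I(H) + (I(G) - I(G - v)) I(H - r).  So the pair
-- (t, ρ) = (I(G; -1), I(G - v; -1)) is transformed linearly by each gadget, the newest vertex of H
-- becoming the new v.  A pendant vertex sends (t, ρ) to (t - ρ, t); a gadget with one triangle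
-- sends it to (2t, ρ), and a chain of three gadgets with one triangle to (2t - ρ, ρ).  Each
-- triangle forces a vertex into every decycling set, and one vertex per triangle suffices, since
-- every other vertex is added with at most one neighbour.  Starting from K₁ and following the
-- binary digits of q + 2ᵏ reaches every q with ∣ q ∣ ≤ 2ᵏ, with φ = k.
module Submission where

open import Defs
open import Data.Nat using (ℕ; suc; _≤_; _^_)
open import Data.Integer using (ℤ; ∣_∣)
open import Data.Product using (Σ; _×_)
open import Relation.Binary.PropositionalEquality using (_≡_)

open import Algebra.Bundles using (CommutativeMonoid)
open import Data.Bool using (Bool; true; false; T; _∧_; _∨_; not; if_then_else_)
open import Data.Bool.Properties using (∧-assoc; ∧-identityʳ; ∧-zeroʳ; ∧-commutativeMonoid; T-∧; T-not-≡)
open import Data.Empty using (⊥-elim)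
open import Data.Fin using (Fin; zero; suc; toℕ; _↑ˡ_; _↑ʳ_; fromℕ; inject₁; #_)
import Data.Fin.Properties as Fin
open import Data.Fin.Subset using (Subset; _∈_; _∉_; ⊤; inside; outside) renaming (∣_∣ to ∣_∣ˢ)
open import Data.Fin.Subset.Properties using (∣p∣≤n; _∈?_; p⊂q⇒∣p∣<∣q∣; x∈p⇒p-x⊂p)
open import Data.Integer using (+_; -_; -[1+_]; _+_; _*_; _-_)
import Data.Integer.Properties as ℤ
open import Data.Integer.Tactic.RingSolver using (solve-∀)
open import Data.List using (List; []; _∷_; map; filter; length) renaming (_++_ to _++ˡ_)
import Data.Nat as ℕ
open import Data.Nat using (zero)
open import Data.Nat.DivMod using (m<n⇒m%n≡m; n%n≡0)
import Data.Nat.Properties as ℕ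
open import Data.Product using (∃; _,_; proj₁; proj₂)
open import Data.Sum using (_⊎_; inj₁; inj₂)
open import Data.Unit using (tt)
open import Data.Vec using ([]; _∷_; here; there; splitAt) renaming (_++_ to _++ᵛ_)
open import Function using (_∘_; Equivalence)
open import Function.Definitions using (Injective)
open import Relation.Nullary using (Dec; yes; no; does; proof)
open import Relation.Nullary.Decidable using (dec-true; dec-false; _×-dec_)
open import Relation.Nullary.Reflects using (fromEquivalence; det)
import Relation.Binary.PropositionalEquality as ≡
open import Relation.Binary.PropositionalEquality
  using (_≢_; refl; trans; cong; cong₂; subst; subst₂; module ≡-Reasoning)
open import Algebra.Properties.CommutativeSemigroup
  (CommutativeMonoid.commutativeSemigroup ∧-commutativeMonoid) using (x∙yz≈y∙xz)

-- Graphs built vertex by vertex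

-- Each new vertex is joined to a chosen set of earlier ones.  The newest vertex has index zero,
-- so a larger index means an older vertex.
data Build : ℕ → Set where
  nil : Build 0
  _▷_ : ∀ {n} → Build n → (Fin n → Bool) → Build (suc n)

infixl 5 _▷_

adjB : ∀ {n} → Build n → Fin n → Fin n → Bool
adjB (B ▷ N) zero    zero    = false
adjB (B ▷ N) zero    (suc j) = N j
adjB (B ▷ N) (suc i) zero    = N i
adjB (B ▷ N) (suc i) (suc j) = adjB B i j

adjB-sym : ∀ {n} (B : Build n) (u v : Fin n) → adjB B u v ≡ adjB B v u
adjB-sym (B ▷ N) zero    zero    = refl
adjB-sym (B ▷ N) zero    (suc j) = refl
adjB-sym (B ▷ N) (suc i) zero    = refl
adjB-sym (B ▷ N) (suc i) (suc j) = adjB-sym B i j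

adjB-irrefl : ∀ {n} (B : Build n) (v : Fin n) → adjB B v v ≡ false
adjB-irrefl (B ▷ N) zero    = refl
adjB-irrefl (B ▷ N) (suc v) = adjB-irrefl B v

graph : ∀ {n} → Build n → Graph
graph {n} B = record { n = n ; adj = adjB B ; sym = adjB-sym B ; irrefl = adjB-irrefl B }

_∖_ : ∀ {n} → Subset n → (Fin n → Bool) → Subset n
[]      ∖ N = []
(x ∷ M) ∖ N = (if N zero then outside else x) ∷ (M ∖ (N ∘ suc))

-- The independence polynomial at -1

-- I₋₁ B M = I(G[M]; -1), by the deletion recurrence I(G) = I(G - v) - I(G - N[v]) at the newest v.
I₋₁ : ∀ {n} → Build n → Subset n → ℤ
I₋₁ nil     []      = + 1
I₋₁ (B ▷ N) (x ∷ M) = I₋₁ B M - (if x then I₋₁ B (M ∖ N) else + 0)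

avoids : ∀ {n} → (Fin n → Bool) → Subset n → Bool
avoids N []      = true
avoids N (x ∷ S) = (if x then not (N zero) else true) ∧ avoids (N ∘ suc) S

independentᵇ : ∀ {n} → Build n → Subset n → Bool
independentᵇ nil     []      = true
independentᵇ (B ▷ N) (x ∷ S) = independentᵇ B S ∧ (if x then avoids N S else true)

_⊆ᵇ_ : ∀ {n} → Subset n → Subset n → Bool
[]      ⊆ᵇ []      = true
(x ∷ S) ⊆ᵇ (y ∷ M) = (if x then y else true) ∧ (S ⊆ᵇ M)

avoids-∧-⊆ᵇ : ∀ {n} (N : Fin n → Bool) (S M : Subset n) → avoids N S ∧ (S ⊆ᵇ M) ≡ S ⊆ᵇ (M ∖ N)
avoids-∧-⊆ᵇ N []            []      = refl
avoids-∧-⊆ᵇ N (outside ∷ S) (y ∷ M) = avoids-∧-⊆ᵇ (N ∘ suc) S M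
avoids-∧-⊆ᵇ N (inside ∷ S)  (y ∷ M) with N zero
... | true  = refl
... | false = trans (x∙yz≈y∙xz (avoids (N ∘ suc) S) y (S ⊆ᵇ M)) (cong (y ∧_) (avoids-∧-⊆ᵇ (N ∘ suc) S M))

⊆ᵇ-⊤ : ∀ {n} (S : Subset n) → S ⊆ᵇ ⊤ ≡ true
⊆ᵇ-⊤ []      = refl
⊆ᵇ-⊤ (inside ∷ S)  = ⊆ᵇ-⊤ S
⊆ᵇ-⊤ (outside ∷ S) = ⊆ᵇ-⊤ S

avoids-complete : ∀ {n} (N : Fin n → Bool) (S : Subset n) →
  (∀ j → j ∈ S → N j ≡ false) → T (avoids N S)
avoids-complete N []            h = tt
avoids-complete N (inside ∷ S)  h = Equivalence.from T-∧
  (Equivalence.from T-not-≡ (h zero here) , avoids-complete (N ∘ suc) S (λ j p → h (suc j) (there p)))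
avoids-complete N (outside ∷ S) h = avoids-complete (N ∘ suc) S (λ j p → h (suc j) (there p))

avoids-sound : ∀ {n} (N : Fin n → Bool) (S : Subset n) →
  T (avoids N S) → ∀ j → j ∈ S → N j ≡ false
avoids-sound N (inside ∷ S)  t zero    here      = Equivalence.to T-not-≡ (proj₁ (Equivalence.to T-∧ t))
avoids-sound N (inside ∷ S)  t (suc j) (there p) = avoids-sound (N ∘ suc) S (proj₂ (Equivalence.to T-∧ t)) j p
avoids-sound N (outside ∷ S) t (suc j) (there p) = avoids-sound (N ∘ suc) S t j p

independentᵇ-complete : ∀ {n} (B : Build n) (S : Subset n) →
  Independent (graph B) S → T (independentᵇ B S)
independentᵇ-complete nil     []      h = tt
independentᵇ-complete (B ▷ N) (x ∷ S) h = Equivalence.from T-∧ (older , newest x h)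
  where
  older : T (independentᵇ B S)
  older = independentᵇ-complete B S (λ u v p q → h (suc u) (suc v) (there p) (there q))
  newest : ∀ x → Independent (graph (B ▷ N)) (x ∷ S) → T (if x then avoids N S else true)
  newest true  h = avoids-complete N S (λ j p → h zero (suc j) here (there p))
  newest false h = tt

independentᵇ-sound : ∀ {n} (B : Build n) (S : Subset n) →
  T (independentᵇ B S) → Independent (graph B) S
independentᵇ-sound (B ▷ N) (x ∷ S) t zero    zero    _         _         = refl
independentᵇ-sound (B ▷ N) (x ∷ S) t zero    (suc j) here      (there q) =
  avoids-sound N S (proj₂ (Equivalence.to T-∧ t)) j q
independentᵇ-sound (B ▷ N) (x ∷ S) t (suc i) zero    (there p) here      =
  avoids-sound N S (proj₂ (Equivalence.to T-∧ t)) i p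
independentᵇ-sound (B ▷ N) (x ∷ S) t (suc i) (suc j) (there p) (there q) =
  independentᵇ-sound B S (proj₁ (Equivalence.to T-∧ t)) i j p q

does-independent? : ∀ {n} (B : Build n) (S : Subset n) →
  does (independent? (graph B) S) ≡ independentᵇ B S
does-independent? B S = det (proof (independent? (graph B) S))
  (fromEquivalence (independentᵇ-sound B S) (independentᵇ-complete B S))

∑ : ∀ {A : Set} → (A → ℤ) → List A → ℤ
∑ f []       = + 0
∑ f (x ∷ xs) = f x + ∑ f xs

∑-++ : ∀ {A : Set} (f : A → ℤ) xs ys → ∑ f (xs ++ˡ ys) ≡ ∑ f xs + ∑ f ys
∑-++ f []       ys = ≡.sym (ℤ.+-identityˡ _)
∑-++ f (x ∷ xs) ys = trans (cong (_+_ (f x)) (∑-++ f xs ys)) (≡.sym (ℤ.+-assoc (f x) _ _))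

∑-map : ∀ {A B : Set} (f : B → ℤ) (g : A → B) xs → ∑ f (map g xs) ≡ ∑ (f ∘ g) xs
∑-map f g []       = refl
∑-map f g (x ∷ xs) = cong (_+_ (f (g x))) (∑-map f g xs)

∑-cong : ∀ {A : Set} {f g : A → ℤ} → (∀ x → f x ≡ g x) → ∀ xs → ∑ f xs ≡ ∑ g xs
∑-cong f≗g []       = refl
∑-cong f≗g (x ∷ xs) = cong₂ _+_ (f≗g x) (∑-cong f≗g xs)

∑-+ : ∀ {A : Set} (f g : A → ℤ) xs → ∑ (λ x → f x + g x) xs ≡ ∑ f xs + ∑ g xs
∑-+ f g []       = refl
∑-+ f g (x ∷ xs) rewrite ∑-+ f g xs = interchange (f x) (g x) (∑ f xs) (∑ g xs)
  where
  interchange : ∀ a b c d → (a + b) + (c + d) ≡ (a + c) + (b + d)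
  interchange = solve-∀

∑-neg : ∀ {A : Set} (f : A → ℤ) xs → ∑ (-_ ∘ f) xs ≡ - ∑ f xs
∑-neg f []       = refl
∑-neg f (x ∷ xs) rewrite ∑-neg f xs = ≡.sym (ℤ.neg-distrib-+ (f x) (∑ f xs))

∑-0 : ∀ {A : Set} (xs : List A) → ∑ (λ _ → + 0) xs ≡ + 0
∑-0 []       = refl
∑-0 (x ∷ xs) = trans (ℤ.+-identityˡ _) (∑-0 xs)

∑-*ʳ : ∀ {A : Set} (f : A → ℤ) c xs → ∑ (λ x → f x * c) xs ≡ ∑ f xs * c
∑-*ʳ f c []       = refl
∑-*ʳ f c (x ∷ xs) rewrite ∑-*ʳ f c xs = ≡.sym (ℤ.*-distribʳ-+ c (f x) (∑ f xs))

signedIndep : ∀ {n} → Build n → Subset n → Subset n → ℤ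
signedIndep B M S = if independentᵇ B S ∧ (S ⊆ᵇ M) then signPow ∣ S ∣ˢ else + 0

∑-signedIndep≡I₋₁ : ∀ {n} (B : Build n) (M : Subset n) → ∑ (signedIndep B M) (allSubsets n) ≡ I₋₁ B M
∑-signedIndep≡I₋₁ nil [] = refl
∑-signedIndep≡I₋₁ {suc n} (B ▷ N) (x ∷ M) = begin
  ∑ f (map (inside ∷_) L ++ˡ map (outside ∷_) L)
    ≡⟨ ∑-++ f (map (inside ∷_) L) (map (outside ∷_) L) ⟩
  ∑ f (map (inside ∷_) L) + ∑ f (map (outside ∷_) L)
    ≡⟨ cong₂ _+_ (trans (∑-map f _ L) (with-newest x)) (trans (∑-map f _ L) without-newest) ⟩
  (if x then - I₋₁ B (M ∖ N) else + 0) + I₋₁ B M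
    ≡⟨ recurrence x ⟩
  I₋₁ (B ▷ N) (x ∷ M) ∎
  where
  open ≡-Reasoning
  L = allSubsets n
  f = signedIndep (B ▷ N) (x ∷ M)

  without-newest : ∑ (λ S → f (outside ∷ S)) L ≡ I₋₁ B M
  without-newest = trans (∑-cong drop L) (∑-signedIndep≡I₋₁ B M)
    where
    drop : ∀ S → f (outside ∷ S) ≡ signedIndep B M S
    drop S rewrite ∧-identityʳ (independentᵇ B S) = refl

  with-newest : ∀ x →
    ∑ (λ S → signedIndep (B ▷ N) (x ∷ M) (inside ∷ S)) L ≡ (if x then - I₋₁ B (M ∖ N) else + 0)
  with-newest false = trans (∑-cong vanish L) (∑-0 L)
    where
    vanish : ∀ S → signedIndep (B ▷ N) (false ∷ M) (inside ∷ S) ≡ + 0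
    vanish S rewrite ∧-zeroʳ (independentᵇ B S ∧ avoids N S) = refl
  with-newest true =
    trans (∑-cong negate L) (trans (∑-neg (signedIndep B (M ∖ N)) L) (cong -_ (∑-signedIndep≡I₋₁ B (M ∖ N))))
    where
    negate : ∀ S → signedIndep (B ▷ N) (true ∷ M) (inside ∷ S) ≡ - signedIndep B (M ∖ N) S
    negate S rewrite ∧-assoc (independentᵇ B S) (avoids N S) (S ⊆ᵇ M) | avoids-∧-⊆ᵇ N S M
      with independentᵇ B S ∧ (S ⊆ᵇ (M ∖ N))
    ... | true  = refl
    ... | false = refl

  recurrence : ∀ x → (if x then - I₋₁ B (M ∖ N) else + 0) + I₋₁ B M ≡ I₋₁ (B ▷ N) (x ∷ M)
  recurrence false = trans (ℤ.+-identityˡ (I₋₁ B M)) (≡.sym (ℤ.+-identityʳ (I₋₁ B M)))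
  recurrence true  = ℤ.+-comm (- I₋₁ B (M ∖ N)) (I₋₁ B M)

length-filter : ∀ {A : Set} {P : A → Set} (P? : ∀ x → Dec (P x)) (xs : List A) →
  + length (filter P? xs) ≡ ∑ (λ x → if does (P? x) then + 1 else + 0) xs
length-filter P? []       = refl
length-filter P? (x ∷ xs) with does (P? x)
... | true  = cong (_+_ (+ 1)) (length-filter P? xs)
... | false = trans (length-filter P? xs) (≡.sym (ℤ.+-identityˡ _))

-- Σ_{j ≤ m} [b ∧ c = j] (-1)^j, the contribution to partialEval of a set of size c, independent iff b.
signedCount : Bool → ℕ → ℕ → ℤ
signedCount b c zero    = if b ∧ does (c ℕ.≟ 0) then + 1 else + 0
signedCount b c (suc m) =
  signedCount b c m + (if b ∧ does (c ℕ.≟ suc m) then + 1 else + 0) * signPow (suc m)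

partialEval≡∑ : ∀ (G : Graph) m →
  partialEval G m ≡ ∑ (λ S → signedCount (does (independent? G S)) ∣ S ∣ˢ m) (allSubsets (n G))
partialEval≡∑ G zero    = length-filter (λ S → independent? G S ×-dec (∣ S ∣ˢ ℕ.≟ 0)) (allSubsets (n G))
partialEval≡∑ G (suc m) = begin
  partialEval G m + + length (filter (sized (suc m)) subsets) * signPow (suc m)
    ≡⟨ cong₂ _+_ (partialEval≡∑ G m)
         (trans (cong (_* signPow (suc m)) (length-filter (sized (suc m)) subsets))
                (≡.sym (∑-*ʳ _ (signPow (suc m)) subsets))) ⟩
  ∑ (λ S → signedCount (does (independent? G S)) ∣ S ∣ˢ m) subsets
    + ∑ (λ S → (if does (sized (suc m) S) then + 1 else + 0) * signPow (suc m)) subsets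
    ≡⟨ ≡.sym (∑-+ _ _ subsets) ⟩
  ∑ (λ S → signedCount (does (independent? G S)) ∣ S ∣ˢ (suc m)) subsets ∎
  where
  open ≡-Reasoning
  subsets = allSubsets (n G)
  sized : ∀ j S → Dec (Independent G S × ∣ S ∣ˢ ≡ j)
  sized j S = independent? G S ×-dec (∣ S ∣ˢ ℕ.≟ j)

signedCount-false : ∀ c m → signedCount false c m ≡ + 0
signedCount-false c zero    = refl
signedCount-false c (suc m) rewrite signedCount-false c m = refl

signedCount-true-< : ∀ c m → m ℕ.< c → signedCount true c m ≡ + 0
signedCount-true-< c zero    m<c rewrite dec-false (c ℕ.≟ 0) (ℕ.>⇒≢ m<c) = refl
signedCount-true-< c (suc m) m<c rewrite signedCount-true-< c m (ℕ.<-trans (ℕ.n<1+n m) m<c)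
                                  | dec-false (c ℕ.≟ suc m) (ℕ.>⇒≢ m<c) = refl

signedCount-true-≥ : ∀ c m → c ≤ m → signedCount true c m ≡ signPow c
signedCount-true-≥ .0 zero    ℕ.z≤n = refl
signedCount-true-≥ c  (suc m) c≤m   with c ℕ.≟ suc m
... | yes refl rewrite signedCount-true-< (suc m) m (ℕ.n<1+n m) | dec-true (suc m ℕ.≟ suc m) refl =
  trans (ℤ.+-identityˡ _) (ℤ.*-identityˡ (signPow (suc m)))
... | no c≢m   rewrite signedCount-true-≥ c m (ℕ.≤-pred (ℕ.≤∧≢⇒< c≤m c≢m)) | dec-false (c ℕ.≟ suc m) c≢m =
  ℤ.+-identityʳ (signPow c)

signedCount-≥ : ∀ b c m → c ≤ m → signedCount b c m ≡ (if b then signPow c else + 0)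
signedCount-≥ true  c m c≤m = signedCount-true-≥ c m c≤m
signedCount-≥ false c m _   = signedCount-false c m

indepPolyAtMinusOne≡I₋₁ : ∀ {n} (B : Build n) → indepPolyAtMinusOne (graph B) ≡ I₋₁ B ⊤
indepPolyAtMinusOne≡I₋₁ {n} B =
  trans (partialEval≡∑ (graph B) n)
    (trans (∑-cong summand (allSubsets n)) (∑-signedIndep≡I₋₁ B ⊤))
  where
  summand : ∀ S → signedCount (does (independent? (graph B) S)) ∣ S ∣ˢ n ≡ signedIndep B ⊤ S
  summand S rewrite signedCount-≥ (does (independent? (graph B) S)) ∣ S ∣ˢ n (∣p∣≤n S)
                  | does-independent? B S | ⊆ᵇ-⊤ S | ∧-identityʳ (independentᵇ B S) = refl

-- Attaching gadgets

hot : ∀ {n} → Fin n → Fin n → Bool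
hot p j = does (j Fin.≟ p)

extend : ∀ {h m} → (Fin h → Bool) → Fin (h ℕ.+ m) → Bool
extend {zero}  N j       = false
extend {suc h} N zero    = N zero
extend {suc h} N (suc j) = extend (N ∘ suc) j

-- G ⊕ H adds the vertices of H to G, oldest first, and joins the oldest of them (the root of H)
-- to the newest vertex of G.
_⊕_ : ∀ {m n} → Build (suc m) → Build (suc n) → Build (suc n ℕ.+ suc m)
G ⊕ (nil ▷ _)   = G ▷ hot zero
G ⊕ (H ▷ M ▷ N) = (G ⊕ (H ▷ M)) ▷ extend N

dropRoot : ∀ {n} → Subset (suc n) → Subset (suc n)
dropRoot (_ ∷ [])    = outside ∷ []
dropRoot (x ∷ y ∷ M) = x ∷ dropRoot (y ∷ M)

∖-none : ∀ {n} (N : Fin n → Bool) → (∀ j → N j ≡ false) → (M : Subset n) → M ∖ N ≡ M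
∖-none N none []      = refl
∖-none N none (x ∷ M) rewrite none zero = cong (x ∷_) (∖-none (N ∘ suc) (none ∘ suc) M)

∖-extend : ∀ {h m} (N : Fin h → Bool) (M : Subset h) (M′ : Subset m) →
  (M ++ᵛ M′) ∖ extend N ≡ (M ∖ N) ++ᵛ M′
∖-extend N []      M′ = ∖-none _ (λ _ → refl) M′
∖-extend N (x ∷ M) M′ = cong (_ ∷_) (∖-extend (N ∘ suc) M M′)

dropRoot-∖ : ∀ {h} (N : Fin (suc h) → Bool) (M : Subset (suc h)) → dropRoot (M ∖ N) ≡ dropRoot M ∖ N
dropRoot-∖ N (x ∷ []) with N zero
... | true  = refl
... | false = refl
dropRoot-∖ N (x ∷ y ∷ M) = cong (_ ∷_) (dropRoot-∖ (N ∘ suc) (y ∷ M))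

-- An independent set of G ⊕ H either avoids the newest vertex of G, or contains it and avoids
-- the root of H.
I₋₁-⊕ : ∀ {m n} (G : Build (suc m)) (H : Build (suc n)) (M : Subset (suc n)) →
  I₋₁ (G ⊕ H) (M ++ᵛ ⊤) ≡
    I₋₁ G (outside ∷ ⊤) * I₋₁ H M + (I₋₁ G ⊤ - I₋₁ G (outside ∷ ⊤)) * I₋₁ H (dropRoot M)
I₋₁-⊕ {m} G (nil ▷ _) (true ∷ []) rewrite ∖-none (hot zero ∘ suc) (λ _ → refl) (⊤ {m}) =
  root-in (I₋₁ G ⊤) (I₋₁ G (outside ∷ ⊤))
  where
  root-in : ∀ t ρ → t - ρ ≡ ρ * (+ 1 - + 1) + (t - ρ) * (+ 1 - + 0)
  root-in = solve-∀
I₋₁-⊕ G (nil ▷ _) (false ∷ []) = root-out (I₋₁ G ⊤) (I₋₁ G (outside ∷ ⊤))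
  where
  root-out : ∀ t ρ → t - + 0 ≡ ρ * (+ 1 - + 0) + (t - ρ) * (+ 1 - + 0)
  root-out = solve-∀
I₋₁-⊕ {m} G (H ▷ M ▷ N) (true ∷ y ∷ M′)
  rewrite ∖-extend N (y ∷ M′) (⊤ {suc m}) | I₋₁-⊕ G (H ▷ M) (y ∷ M′) | I₋₁-⊕ G (H ▷ M) ((y ∷ M′) ∖ N)
        | dropRoot-∖ N (y ∷ M′) =
  newest-in (I₋₁ G ⊤) (I₋₁ G (outside ∷ ⊤)) _ _ _ _
  where
  newest-in : ∀ t ρ x x′ y y′ →
    (ρ * x + (t - ρ) * x′) - (ρ * y + (t - ρ) * y′) ≡ ρ * (x - y) + (t - ρ) * (x′ - y′)
  newest-in = solve-∀
I₋₁-⊕ G (H ▷ M ▷ N) (false ∷ y ∷ M′) rewrite I₋₁-⊕ G (H ▷ M) (y ∷ M′) =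
  newest-out (I₋₁ G ⊤) (I₋₁ G (outside ∷ ⊤)) _ _
  where
  newest-out : ∀ t ρ x x′ → (ρ * x + (t - ρ) * x′) - + 0 ≡ ρ * (x - + 0) + (t - ρ) * (x′ - + 0)
  newest-out = solve-∀

-- Connectivity

_++ʷ_ : ∀ {G : Graph} {u v w} → Walk G u v → Walk G v w → Walk G u w
here     ++ʷ q = q
step a p ++ʷ q = step a (p ++ʷ q)

reverseʷ : ∀ {G : Graph} {u v} → Walk G u v → Walk G v u
reverseʷ         here               = here
reverseʷ {G = G} (step {u} {w} a p) = reverseʷ p ++ʷ step (trans (Graph.sym G w u) a) here

sucʷ : ∀ {n} {B : Build n} {N : Fin n → Bool} {u v} →
  Walk (graph B) u v → Walk (graph (B ▷ N)) (suc u) (suc v)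
sucʷ here       = here
sucʷ (step a p) = step a (sucʷ p)

HasNeighbour : ∀ {n} → (Fin n → Bool) → Set
HasNeighbour {zero}  N = Data.Unit.⊤
HasNeighbour {suc n} N = ∃ λ p → N p ≡ true

Attached : ∀ {n} → Build n → Set
Attached nil     = Data.Unit.⊤
Attached (B ▷ N) = Attached B × HasNeighbour N

attached⇒connected : ∀ {n} (B : Build n) → Attached B → Connected (graph B)
attached⇒connected (nil ▷ N)         _                   zero zero = here
attached⇒connected (_▷_ {suc n} B N) (attached , p , Np) u    v    =
  toNewest u ++ʷ reverseʷ (toNewest v)
  where
  toNewest : ∀ u → Walk (graph (B ▷ N)) u zero
  toNewest zero    = here
  toNewest (suc u) = sucʷ (attached⇒connected B attached u p) ++ʷ step Np here

extend-↑ˡ : ∀ {h m} (N : Fin h → Bool) (p : Fin h) → extend {h} {m} N (p ↑ˡ m) ≡ N p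
extend-↑ˡ N zero    = refl
extend-↑ˡ N (suc p) = extend-↑ˡ (N ∘ suc) p

attached-⊕ : ∀ {m n} (G : Build (suc m)) (H : Build (suc n)) → Attached G → Attached H → Attached (G ⊕ H)
attached-⊕ G (nil ▷ _)   aG _              = aG , zero , refl
attached-⊕ {m} G (H ▷ M ▷ N) aG (aH , p , Np) =
  attached-⊕ G (H ▷ M) aG aH , p ↑ˡ suc m , trans (extend-↑ˡ N p) Np

-- Acyclicity

module CyclicIndex (L : ℕ) where

  next : Fin (3 ℕ.+ L) → Fin (3 ℕ.+ L)
  next = nextIdx L

  prev : Fin (3 ℕ.+ L) → Fin (3 ℕ.+ L)
  prev zero    = fromℕ (2 ℕ.+ L)
  prev (suc j) = inject₁ j

  toℕ-next-< : ∀ i → suc (toℕ i) ℕ.< 3 ℕ.+ L → toℕ (next i) ≡ suc (toℕ i)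
  toℕ-next-< i i+1<3+L = trans (Fin.toℕ-fromℕ< _) (m<n⇒m%n≡m i+1<3+L)

  toℕ-next-last : ∀ i → toℕ i ≡ 2 ℕ.+ L → toℕ (next i) ≡ 0
  toℕ-next-last i last =
    trans (Fin.toℕ-fromℕ< _) (trans (cong (λ k → suc k ℕ.% (3 ℕ.+ L)) last) (n%n≡0 (3 ℕ.+ L)))

  toℕ-next : ∀ i → (toℕ (next i) ≡ suc (toℕ i)) ⊎ (toℕ i ≡ 2 ℕ.+ L × toℕ (next i) ≡ 0)
  toℕ-next i with ℕ.m≤n⇒m<n∨m≡n (Fin.toℕ<n i)
  ... | inj₁ i+1<3+L = inj₁ (toℕ-next-< i i+1<3+L)
  ... | inj₂ i+1≡3+L = inj₂ (last , toℕ-next-last i last)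
    where last = ℕ.suc-injective i+1≡3+L

  next-prev : ∀ i → next (prev i) ≡ i
  next-prev zero    = Fin.toℕ-injective (toℕ-next-last (fromℕ (2 ℕ.+ L)) (Fin.toℕ-fromℕ (2 ℕ.+ L)))
  next-prev (suc j) = Fin.toℕ-injective (trans (toℕ-next-< (inject₁ j) (ℕ.s≤s (Fin.inject₁ℕ< j)))
                                               (cong suc (Fin.toℕ-inject₁ j)))

  next≢id : ∀ i → next i ≢ i
  next≢id i e with toℕ-next i
  ... | inj₁ incr           = ℕ.1+n≢n (trans (≡.sym incr) (cong toℕ e))
  ... | inj₂ (last , wraps) = ℕ.0≢1+n (trans (≡.sym wraps) (trans (cong toℕ e) last))

  next²≢id : ∀ i → next (next i) ≢ i
  next²≢id i e with toℕ-next i | toℕ-next (next i)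
  ... | inj₁ incr | inj₁ incr′ =
    ℕ.<⇒≢ (ℕ.m<n⇒m<1+n (ℕ.n<1+n (toℕ i))) (trans (≡.sym (cong toℕ e)) (trans incr′ (cong suc incr)))
  ... | inj₁ incr | inj₂ (last′ , wraps′) =
    ℕ.0≢1+n (ℕ.suc-injective (trans (cong suc (trans (≡.sym wraps′) (cong toℕ e))) (trans (≡.sym incr) last′)))
  ... | inj₂ (last , wraps) | inj₁ incr′ =
    ℕ.0≢1+n (ℕ.suc-injective (trans (trans (cong suc (≡.sym wraps)) (≡.sym incr′)) (trans (cong toℕ e) last)))
  ... | inj₂ (last , wraps) | inj₂ (last′ , wraps′) =
    ℕ.0≢1+n (trans (≡.sym wraps) last′)

UniqueOlderNeighbour : (G : Graph) → Subset (n G) → Set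
UniqueOlderNeighbour G S = ∀ {v u w} → v ∉ S → u ∉ S → w ∉ S → Adj G v u → Adj G v w →
  toℕ v ℕ.< toℕ u → toℕ v ℕ.< toℕ w → u ≡ w

argmin : ∀ {m} (f : Fin (suc m) → ℕ) → Σ (Fin (suc m)) λ i → ∀ j → f i ≤ f j
argmin {zero}  f = zero , λ { zero → ℕ.≤-refl }
argmin {suc m} f with argmin (f ∘ suc)
... | i , min with ℕ.≤-total (f zero) (f (suc i))
...   | inj₁ f0≤ = zero  , λ { zero → ℕ.≤-refl ; (suc j) → ℕ.≤-trans f0≤ (min j) }
...   | inj₂ ≤f0 = suc i , λ { zero → ≤f0     ; (suc j) → min j }

-- The newest vertex of a cycle avoiding S has two distinct older neighbours on the cycle.
unique-older⇒acyclic : (G : Graph) (S : Subset (n G)) →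
  UniqueOlderNeighbour G S → AcyclicAfterRemoving G S
unique-older⇒acyclic G S unique (C , avoids-S) =
  next²≢id i (trans (cong next (vert-injective same)) (next-prev i))
  where
  open Cycle C renaming (vert to c; distinct to vert-injective; adjacent to c-adj)
  open CyclicIndex len
  i = proj₁ (argmin (toℕ ∘ c))
  older : ∀ j → j ≢ i → toℕ (c i) ℕ.< toℕ (c j)
  older j j≢i = ℕ.≤∧≢⇒< (proj₂ (argmin (toℕ ∘ c)) j)
                         (λ e → j≢i (≡.sym (vert-injective (Fin.toℕ-injective e))))
  adj-prev : Adj G (c i) (c (prev i))
  adj-prev = trans (Graph.sym G (c i) (c (prev i)))
                   (subst (λ x → Adj G (c (prev i)) (c x)) (next-prev i) (c-adj (prev i)))
  same : c (next i) ≡ c (prev i)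
  same = unique (avoids-S i) (avoids-S (next i)) (avoids-S (prev i)) (c-adj i) adj-prev
    (older (next i) (next≢id i))
    (older (prev i) (λ e → next≢id i (subst (λ x → next x ≡ i) e (next-prev i))))

AtMostOne : ∀ {n} → (Fin n → Bool) → Set
AtMostOne N = ∀ i j → N i ≡ true → N j ≡ true → i ≡ j

TreelikeOutside : ∀ {n} → Build n → Subset n → Set
TreelikeOutside nil     []      = Data.Unit.⊤
TreelikeOutside (B ▷ N) (x ∷ S) = TreelikeOutside B S × (x ≡ inside ⊎ AtMostOne N)

treelike⇒unique-older : ∀ {n} (B : Build n) (S : Subset n) →
  TreelikeOutside B S → UniqueOlderNeighbour (graph B) S
treelike⇒unique-older (B ▷ N) (x ∷ S) (tB , inj₁ refl) {zero} v∉ _ _ _ _ _ _ = ⊥-elim (v∉ here)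
treelike⇒unique-older (B ▷ N) (x ∷ S) (tB , inj₂ one) {zero} {suc u} {suc w} _ _ _ vu vw _ _ =
  cong suc (one u w vu vw)
treelike⇒unique-older (B ▷ N) (x ∷ S) (tB , _) {suc v} {suc u} {suc w} v∉ u∉ w∉ vu vw (ℕ.s≤s v<u) (ℕ.s≤s v<w) =
  cong suc (treelike⇒unique-older B S tB (v∉ ∘ there) (u∉ ∘ there) (w∉ ∘ there) vu vw v<u v<w)

atMostOne-hot : ∀ {n} (p : Fin n) → AtMostOne (hot p)
atMostOne-hot p i j hi hj with i Fin.≟ p | j Fin.≟ p
... | yes refl | yes refl = refl

extend-true : ∀ {h m} (N : Fin h → Bool) (j : Fin (h ℕ.+ m)) → extend {h} {m} N j ≡ true →
  Σ (Fin h) λ i → i ↑ˡ m ≡ j × N i ≡ true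
extend-true {suc h} N zero    Nj = zero , refl , Nj
extend-true {suc h} N (suc j) Nj with extend-true (N ∘ suc) j Nj
... | i , refl , Ni = suc i , refl , Ni

atMostOne-extend : ∀ {h m} (N : Fin h → Bool) → AtMostOne N → AtMostOne (extend {h} {m} N)
atMostOne-extend {m = m} N one i j Ni Nj with extend-true {m = m} N i Ni | extend-true {m = m} N j Nj
... | i′ , refl , Ni′ | j′ , refl , Nj′ = cong (_↑ˡ m) (one i′ j′ Ni′ Nj′)

treelike-⊕ : ∀ {m n} (G : Build (suc m)) (H : Build (suc n)) (SG : Subset (suc m)) (SH : Subset (suc n)) →
  TreelikeOutside G SG → TreelikeOutside H SH → TreelikeOutside (G ⊕ H) (SH ++ᵛ SG)
treelike-⊕ G (nil ▷ _)   SG (x ∷ [])  tG _          = tG , inj₂ (atMostOne-hot zero)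
treelike-⊕ G (H ▷ M ▷ N) SG (x ∷ SH) tG (tH , tN) =
  treelike-⊕ G (H ▷ M) SG SH tG tH , Data.Sum.map₂ (atMostOne-extend N) tN

-- Lower bounds for the decycling number

DecyclingLowerBound : Graph → ℕ → Set
DecyclingLowerBound G k = ∀ S → AcyclicAfterRemoving G S → k ≤ ∣ S ∣ˢ

mapCycle : ∀ {G G′ : Graph} (f : Fin (n G) → Fin (n G′)) → Injective _≡_ _≡_ f →
  (∀ {u v} → Adj G u v → Adj G′ (f u) (f v)) → Cycle G → Cycle G′
mapCycle f f-injective f-adj C = record
  { len      = len
  ; vert     = f ∘ vert
  ; distinct = distinct ∘ f-injective
  ; adjacent = f-adj ∘ adjacent
  }
  where open Cycle C

acyclic-pullback : ∀ {G G′ : Graph} (f : Fin (n G) → Fin (n G′)) → Injective _≡_ _≡_ f →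
  (∀ {u v} → Adj G u v → Adj G′ (f u) (f v)) → (S : Subset (n G)) (S′ : Subset (n G′)) →
  (∀ v → f v ∈ S′ → v ∈ S) → AcyclicAfterRemoving G′ S′ → AcyclicAfterRemoving G S
acyclic-pullback f f-injective f-adj S S′ reflect acyclic (C , avoids-S) =
  acyclic (mapCycle f f-injective f-adj C , λ i → avoids-S i ∘ reflect _)

adj-⊕-↑ˡ : ∀ {m n} (G : Build (suc m)) (H : Build (suc n)) (i j : Fin (suc n)) →
  adjB (G ⊕ H) (i ↑ˡ suc m) (j ↑ˡ suc m) ≡ adjB H i j
adj-⊕-↑ˡ G (nil ▷ _)   zero    zero    = refl
adj-⊕-↑ˡ G (H ▷ M ▷ N) zero    zero    = refl
adj-⊕-↑ˡ G (H ▷ M ▷ N) zero    (suc j) = extend-↑ˡ N j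
adj-⊕-↑ˡ G (H ▷ M ▷ N) (suc i) zero    = extend-↑ˡ N i
adj-⊕-↑ˡ G (H ▷ M ▷ N) (suc i) (suc j) = adj-⊕-↑ˡ G (H ▷ M) i j

adj-⊕-↑ʳ : ∀ {m n} (G : Build (suc m)) (H : Build (suc n)) (i j : Fin (suc m)) →
  adjB (G ⊕ H) (suc n ↑ʳ i) (suc n ↑ʳ j) ≡ adjB G i j
adj-⊕-↑ʳ G (nil ▷ _)   i j = refl
adj-⊕-↑ʳ G (H ▷ M ▷ N) i j = adj-⊕-↑ʳ G (H ▷ M) i j

∈-++⁻ˡ : ∀ {a b} (S : Subset a) (T : Subset b) (x : Fin a) → x ↑ˡ b ∈ S ++ᵛ T → x ∈ S
∈-++⁻ˡ (s ∷ S) T zero    here      = here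
∈-++⁻ˡ (s ∷ S) T (suc x) (there p) = there (∈-++⁻ˡ S T x p)

∈-++⁻ʳ : ∀ {a b} (S : Subset a) (T : Subset b) (x : Fin b) → a ↑ʳ x ∈ S ++ᵛ T → x ∈ T
∈-++⁻ʳ []      T x p         = p
∈-++⁻ʳ (s ∷ S) T x (there p) = ∈-++⁻ʳ S T x p

∣++∣ : ∀ {a b} (S : Subset a) (T : Subset b) → ∣ S ++ᵛ T ∣ˢ ≡ ∣ S ∣ˢ ℕ.+ ∣ T ∣ˢ
∣++∣ []            T = refl
∣++∣ (inside ∷ S)  T = cong suc (∣++∣ S T)
∣++∣ (outside ∷ S) T = ∣++∣ S T

lower-bound-⊕ : ∀ {m n c k} (G : Build (suc m)) (H : Build (suc n)) →
  DecyclingLowerBound (graph H) c → DecyclingLowerBound (graph G) k →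
  DecyclingLowerBound (graph (G ⊕ H)) (c ℕ.+ k)
lower-bound-⊕ {m} {n} G H lbH lbG S acyclic with splitAt (suc n) S
... | SH , SG , refl = subst (_ ≤_) (≡.sym (∣++∣ SH SG)) (ℕ.+-mono-≤
  (lbH SH (acyclic-pullback (_↑ˡ suc m) (Fin.↑ˡ-injective (suc m) _ _)
             (λ {u} {v} a → trans (adj-⊕-↑ˡ G H u v) a) SH S (∈-++⁻ˡ SH SG) acyclic))
  (lbG SG (acyclic-pullback (suc n ↑ʳ_) (Fin.↑ʳ-injective (suc n) _ _)
             (λ {u} {v} a → trans (adj-⊕-↑ʳ G H u v) a) SG S (∈-++⁻ʳ SH SG) acyclic)))

cycle⇒lower-bound : ∀ {G : Graph} → Cycle G → DecyclingLowerBound G 1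
cycle⇒lower-bound {G} C S acyclic with Fin.any? (λ i → Cycle.vert C i ∈? S)
... | yes (i , hit) = ℕ.≤-trans (ℕ.s≤s ℕ.z≤n) (p⊂q⇒∣p∣<∣q∣ (x∈p⇒p-x⊂p hit))
... | no  miss      = ⊥-elim (acyclic (C , λ i hit → miss (i , hit)))

triangle : ∀ {G : Graph} (x y z : Fin (n G)) → x ≢ y → y ≢ z → x ≢ z →
  Adj G x y → Adj G y z → Adj G z x → Cycle G
triangle {G} x y z x≢y y≢z x≢z xy yz zx =
  record { len = 0 ; vert = c ; distinct = injective ; adjacent = adjacent }
  where
  c : Fin 3 → Fin (n G)
  c zero             = x
  c (suc zero)       = y
  c (suc (suc zero)) = z
  injective : Injective _≡_ _≡_ c
  injective {zero}             {zero}             _ = refl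
  injective {zero}             {suc zero}         e = ⊥-elim (x≢y e)
  injective {zero}             {suc (suc zero)}   e = ⊥-elim (x≢z e)
  injective {suc zero}         {zero}             e = ⊥-elim (x≢y (≡.sym e))
  injective {suc zero}         {suc zero}         _ = refl
  injective {suc zero}         {suc (suc zero)}   e = ⊥-elim (y≢z e)
  injective {suc (suc zero)}   {zero}             e = ⊥-elim (x≢z (≡.sym e))
  injective {suc (suc zero)}   {suc zero}         e = ⊥-elim (y≢z (≡.sym e))
  injective {suc (suc zero)}   {suc (suc zero)}   _ = refl
  adjacent : ∀ i → Adj G (c i) (c (nextIdx 0 i))
  adjacent zero             = xy
  adjacent (suc zero)       = yz
  adjacent (suc (suc zero)) = zx

-- Realizable values

⊤-++ : ∀ a b → ⊤ {a ℕ.+ b} ≡ ⊤ {a} ++ᵛ ⊤ {b}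
⊤-++ zero    b = refl
⊤-++ (suc a) b = cong (inside ∷_) (⊤-++ a b)

record Realizes (k : ℕ) (t ρ : ℤ) : Set where
  field
    order            : ℕ
    build            : Build (suc order)
    attached         : Attached build
    decycler         : Subset (suc order)
    treelike         : TreelikeOutside build decycler
    decycler-size    : ∣ decycler ∣ˢ ≡ k
    lower-bound      : DecyclingLowerBound (graph build) k
    I-total          : I₋₁ build ⊤ ≡ t
    I-without-newest : I₋₁ build (outside ∷ ⊤) ≡ ρ

attach : ∀ {c k x y t ρ} (H : Realizes c x y) → Realizes k t ρ →
  Realizes (c ℕ.+ k)
    (ρ * x + (t - ρ) * I₋₁ (Realizes.build H) (dropRoot ⊤))
    (ρ * y + (t - ρ) * I₋₁ (Realizes.build H) (dropRoot (outside ∷ ⊤)))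
attach {t = t} {ρ} H G = record
  { order            = H.order ℕ.+ suc G.order
  ; build            = G.build ⊕ H.build
  ; attached         = attached-⊕ G.build H.build G.attached H.attached
  ; decycler         = H.decycler ++ᵛ G.decycler
  ; treelike         = treelike-⊕ G.build H.build G.decycler H.decycler G.treelike H.treelike
  ; decycler-size    = trans (∣++∣ H.decycler G.decycler) (cong₂ ℕ._+_ H.decycler-size G.decycler-size)
  ; lower-bound      = lower-bound-⊕ G.build H.build H.lower-bound G.lower-bound
  ; I-total          = trans (cong (I₋₁ (G.build ⊕ H.build)) (⊤-++ (suc H.order) (suc G.order)))
                             (trans (I₋₁-⊕ G.build H.build ⊤) (values H.I-total))
  ; I-without-newest = trans (cong (λ M → I₋₁ (G.build ⊕ H.build) (outside ∷ M)) (⊤-++ H.order (suc G.order)))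
                             (trans (I₋₁-⊕ G.build H.build (outside ∷ ⊤)) (values H.I-without-newest))
  }
  where
  module G = Realizes G
  module H = Realizes H
  values : ∀ {M z} → I₋₁ H.build M ≡ z →
    I₋₁ G.build (outside ∷ ⊤) * I₋₁ H.build M
      + (I₋₁ G.build ⊤ - I₋₁ G.build (outside ∷ ⊤)) * I₋₁ H.build (dropRoot M)
      ≡ ρ * z + (t - ρ) * I₋₁ H.build (dropRoot M)
  values {M} refl rewrite G.I-total | G.I-without-newest = refl

-- In the gadgets below, hot p joins the new vertex to the earlier vertex of index p (0 being the
-- newest), and the first vertex is the root r.

vertex : Realizes 0 (+ 0) (+ 1)
vertex = record
  { order = 0 ; build = nil ▷ λ () ; attached = _ ; decycler = outside ∷ [] ; treelike = _ , inj₂ (λ ())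
  ; decycler-size = refl ; lower-bound = λ _ _ → ℕ.z≤n ; I-total = refl ; I-without-newest = refl }

edge : Realizes 0 (- + 1) (+ 0)
edge = record
  { order = 1 ; build = nil ▷ (λ ()) ▷ hot zero ; attached = _ , zero , refl
  ; decycler = outside ∷ outside ∷ [] ; treelike = (_ , inj₂ (λ ())) , inj₂ (atMostOne-hot zero)
  ; decycler-size = refl ; lower-bound = λ _ _ → ℕ.z≤n ; I-total = refl ; I-without-newest = refl }

-- The path v₃ v₂ v₁ r a.
path₅ : Realizes 0 (+ 1) (+ 0)
path₅ = record
  { order = 4 ; build = nil ▷ (λ ()) ▷ hot zero ▷ hot zero ▷ hot zero ▷ hot (# 3)
  ; attached = (((_ , zero , refl) , zero , refl) , zero , refl) , # 3 , refl
  ; decycler = outside ∷ outside ∷ outside ∷ outside ∷ outside ∷ []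
  ; treelike = ((((_ , inj₂ (λ ())) , inj₂ (atMostOne-hot zero)) , inj₂ (atMostOne-hot zero))
                , inj₂ (atMostOne-hot zero)) , inj₂ (atMostOne-hot (# 3))
  ; decycler-size = refl ; lower-bound = λ _ _ → ℕ.z≤n ; I-total = refl ; I-without-newest = refl }

-- The triangle v₁ v₂ v₃ and the path v₁ r v₄ a.
triangle₁ : Realizes 1 (+ 2) (+ 1)
triangle₁ = record
  { order = 5
  ; build = nil ▷ (λ ()) ▷ hot zero ▷ hot zero ▷ (λ j → hot zero j ∨ hot (# 1) j) ▷ hot (# 3) ▷ hot zero
  ; attached = ((((_ , zero , refl) , zero , refl) , zero , refl) , # 3 , refl) , zero , refl
  ; decycler = outside ∷ outside ∷ inside ∷ outside ∷ outside ∷ outside ∷ []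
  ; treelike = (((((_ , inj₂ (λ ())) , inj₂ (atMostOne-hot zero)) , inj₂ (atMostOne-hot zero)) , inj₁ refl)
               , inj₂ (atMostOne-hot (# 3))) , inj₂ (atMostOne-hot zero)
  ; decycler-size = refl
  ; lower-bound = cycle⇒lower-bound (triangle (# 4) (# 3) (# 2) (λ ()) (λ ()) (λ ()) refl refl refl)
  ; I-total = refl ; I-without-newest = refl }

-- The triangle v₂ v₃ v₄ and the path v₂ v₁ r a.
triangle₂ : Realizes 1 (+ 2) (+ 1)
triangle₂ = record
  { order = 5
  ; build = nil ▷ (λ ()) ▷ hot zero ▷ hot zero ▷ hot zero ▷ (λ j → hot zero j ∨ hot (# 1) j) ▷ hot (# 4)
  ; attached = ((((_ , zero , refl) , zero , refl) , zero , refl) , zero , refl) , # 4 , refl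
  ; decycler = outside ∷ inside ∷ outside ∷ outside ∷ outside ∷ outside ∷ []
  ; treelike = (((((_ , inj₂ (λ ())) , inj₂ (atMostOne-hot zero)) , inj₂ (atMostOne-hot zero))
               , inj₂ (atMostOne-hot zero)) , inj₁ refl) , inj₂ (atMostOne-hot (# 4))
  ; decycler-size = refl
  ; lower-bound = cycle⇒lower-bound (triangle (# 3) (# 2) (# 1) (λ ()) (λ ()) (λ ()) refl refl refl)
  ; I-total = refl ; I-without-newest = refl }

pendant : ∀ {k t ρ} → Realizes k t ρ → Realizes k (t - ρ) t
pendant {k} {t} {ρ} G = subst₂ (Realizes k) (eq₁ t ρ) (eq₂ t ρ) (attach vertex G)
  where
  eq₁ : ∀ t ρ → ρ * + 0 + (t - ρ) * + 1 ≡ t - ρ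
  eq₁ = solve-∀
  eq₂ : ∀ t ρ → ρ * + 1 + (t - ρ) * + 1 ≡ t
  eq₂ = solve-∀

twice : ∀ {k t ρ} → Realizes k t ρ → Realizes (suc k) (+ 2 * t) ρ
twice {k} {t} {ρ} G = subst₂ (Realizes (suc k)) (eq₁ t ρ) (eq₂ t ρ) (attach triangle₁ G)
  where
  eq₁ : ∀ t ρ → ρ * + 2 + (t - ρ) * + 2 ≡ + 2 * t
  eq₁ = solve-∀
  eq₂ : ∀ t ρ → ρ * + 1 + (t - ρ) * + 0 ≡ ρ
  eq₂ = solve-∀

-- edge, triangle₂ and path₅ act as (t, ρ) ↦ (-ρ, t - ρ) ↦ (2(t - ρ), 2t - ρ) ↦ (2t - ρ, ρ).
twiceMinus : ∀ {k t ρ} → Realizes k t ρ → Realizes (suc k) (+ 2 * t - ρ) ρ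
twiceMinus {k} {t} {ρ} G =
  subst₂ (Realizes (suc k)) (eq₁ t ρ) (eq₂ t ρ) (attach path₅ (attach triangle₂ (attach edge G)))
  where
  eq₁ : ∀ t ρ →
    let t₁ = ρ * - + 1 + (t - ρ) * + 0 ; ρ₁ = ρ * + 0 + (t - ρ) * + 1
        t₂ = ρ₁ * + 2 + (t₁ - ρ₁) * + 0 ; ρ₂ = ρ₁ * + 1 + (t₁ - ρ₁) * - + 1
    in ρ₂ * + 1 + (t₂ - ρ₂) * + 0 ≡ + 2 * t - ρ
  eq₁ = solve-∀
  eq₂ : ∀ t ρ →
    let t₁ = ρ * - + 1 + (t - ρ) * + 0 ; ρ₁ = ρ * + 0 + (t - ρ) * + 1
        t₂ = ρ₁ * + 2 + (t₁ - ρ₁) * + 0 ; ρ₂ = ρ₁ * + 1 + (t₁ - ρ₁) * - + 1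
    in ρ₂ * + 0 + (t₂ - ρ₂) * - + 1 ≡ ρ
  eq₂ = solve-∀

-- Reaching every value

data Parity : ℕ → Set where
  even : ∀ j → Parity (2 ℕ.* j)
  odd  : ∀ j → Parity (suc (2 ℕ.* j))

parity : ∀ i → Parity i
parity zero          = even 0
parity (suc zero)    = odd 0
parity (suc (suc i)) with parity i
... | even j = subst Parity (ℕ.*-distribˡ-+ 2 1 j) (even (suc j))
... | odd  j = subst Parity (cong suc (ℕ.*-distribˡ-+ 2 1 j)) (odd (suc j))

-- twice and twiceMinus keep ρ, so with ρ = 1 they reach the values in (-2ᵏ, 2ᵏ] and with ρ = -1
-- those in [-2ᵏ, 2ᵏ).
reach⁺ : ∀ k i → 0 ℕ.< i → i ≤ 2 ^ suc k → Realizes k (+ i - + (2 ^ k)) (+ 1)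
reach⁺ zero    1 _ _ = vertex
reach⁺ zero    2 _ _ = pendant (pendant (pendant (pendant (pendant vertex))))
reach⁺ zero    (suc (suc (suc _))) _ (ℕ.s≤s (ℕ.s≤s ()))
reach⁺ (suc k) i 0<i i≤ with parity i
reach⁺ (suc k) .(2 ℕ.* suc j) _ i≤ | even (suc j) =
  subst (λ v → Realizes (suc k) v (+ 1)) (≡.sym (eq (+ suc j) (+ (2 ^ k))))
    (twice (reach⁺ k (suc j) (ℕ.s≤s ℕ.z≤n) (ℕ.*-cancelˡ-≤ 2 i≤)))
  where
  eq : ∀ x d → (x + (x + + 0)) - (d + (d + + 0)) ≡ + 2 * (x - d)
  eq = solve-∀
reach⁺ (suc k) .(suc (2 ℕ.* j)) _ i≤ | odd j =
  subst (λ v → Realizes (suc k) v (+ 1)) (≡.sym (eq (+ j) (+ (2 ^ k))))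
    (twiceMinus (reach⁺ k (suc j) (ℕ.s≤s ℕ.z≤n) (ℕ.*-cancelˡ-< 2 j (2 ^ suc k) i≤)))
  where
  eq : ∀ x d → + 1 + (x + (x + + 0)) - (d + (d + + 0)) ≡ + 2 * (+ 1 + x - d) - + 1
  eq = solve-∀

reach⁻ : ∀ k i → i ℕ.< 2 ^ suc k → Realizes k (+ i - + (2 ^ k)) (- + 1)
reach⁻ zero    0 _ = pendant (pendant vertex)
reach⁻ zero    1 _ = pendant (pendant (pendant vertex))
reach⁻ zero    (suc (suc _)) (ℕ.s≤s (ℕ.s≤s ()))
reach⁻ (suc k) i i< with parity i
... | even j =
  subst (λ v → Realizes (suc k) v (- + 1)) (≡.sym (eq (+ j) (+ (2 ^ k))))
    (twice (reach⁻ k j (ℕ.*-cancelˡ-< 2 j (2 ^ suc k) i<)))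
  where
  eq : ∀ x d → (x + (x + + 0)) - (d + (d + + 0)) ≡ + 2 * (x - d)
  eq = solve-∀
... | odd j =
  subst (λ v → Realizes (suc k) v (- + 1)) (≡.sym (eq (+ j) (+ (2 ^ k))))
    (twiceMinus (reach⁻ k j (ℕ.*-cancelˡ-< 2 j (2 ^ suc k) (ℕ.<-trans (ℕ.n<1+n _) i<))))
  where
  eq : ∀ x d → + 1 + (x + (x + + 0)) - (d + (d + + 0)) ≡ + 2 * (x - d) - - + 1
  eq = solve-∀

centred : ∀ d (q : ℤ) → ∣ q ∣ ≤ d → Σ ℕ λ i → i ≤ 2 ℕ.* d × + i - + d ≡ q
centred d (+ a) a≤d = a ℕ.+ d , ℕ.+-mono-≤ a≤d (ℕ.m≤m+n d 0) , eq (+ a) (+ d)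
  where
  eq : ∀ x y → x + y - y ≡ x
  eq = solve-∀
centred d -[1+ a ] a<d =
  d ℕ.∸ suc a , ℕ.≤-trans (ℕ.m∸n≤m d (suc a)) (ℕ.m≤m+n d (d ℕ.+ 0)) ,
  subst (λ d′ → + (d ℕ.∸ suc a) - + d′ ≡ -[1+ a ]) (ℕ.m+[n∸m]≡n a<d) (eq (+ (d ℕ.∸ suc a)) (+ a))
  where
  eq : ∀ x y → x - (+ 1 + y + x) ≡ - (+ 1 + y)
  eq = solve-∀

realize : ∀ k (q : ℤ) → ∣ q ∣ ≤ 2 ^ k → Σ ℤ (Realizes k q)
realize k q ∣q∣≤2ᵏ with centred (2 ^ k) q ∣q∣≤2ᵏ
... | i , i≤ , refl with ℕ.m≤n⇒m<n∨m≡n i≤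
...   | inj₁ i<    = - + 1 , reach⁻ k i i<
...   | inj₂ refl = + 1 , reach⁺ k i (ℕ.m^n>0 2 (suc k)) ℕ.≤-refl

realizes⇒graph : ∀ {k q ρ} → Realizes k q ρ →
  Σ Graph λ G → Connected G × DecyclingNumber G k × indepPolyAtMinusOne G ≡ q
realizes⇒graph G =
  graph build , attached⇒connected build attached ,
  ((decycler , unique-older⇒acyclic (graph build) decycler (treelike⇒unique-older build decycler treelike)
             , decycler-size) , lower-bound) ,
  trans (indepPolyAtMinusOne≡I₋₁ build) I-total
  where open Realizes G

-- The construction also works for k = 0, where it yields trees.
theorem2p6 : (k : ℕ) → 1 ≤ k → (q : ℤ) → ∣ q ∣ ≤ 2 ^ k →
    Σ Graph λ G → Connected G × DecyclingNumber G k × indepPolyAtMinusOne G ≡ q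
theorem2p6 k _ q ∣q∣≤2ᵏ = realizes⇒graph (proj₂ (realize k q ∣q∣≤2ᵏ))
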